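{- Let $p$ be an integer greater than $2$ and let $G$ be a graph (with at least one vertex). Then $\mathrm{id}^{\leq p}(G) \leq \frac{1}{p-1}|E(G)| + \frac{p-2}{p-1}(|V(G)|-1)$.
   Context: All graphs are finite and simple. In an oriented graph, the inversion of a vertex set $X$ reverses the orientation of every arc with both endvertices in $X$; a $(\leq p)$-inversion is the inversion of a set of at most $p$ vertices. For a graph $G$ with labelled vertices, $\mathrm{id}^{\leq p}(G)$ is the maximum, over all pairs of orientations $\vec G_1,\vec G_2$ of $G$, of the minimum number of $(\leq p)$-inversions transforming $\vec G_1$ into $\vec G_2$. -}

module Defs where

open import Data.Nat using (ℕ; zero; suc; _+_; _*_; _∸_; _≤_)
open import Data.Bool using (Bool; true; false; _∧_; if_then_else_; T; not)
open import Data.Fin using (Fin; toℕ; _<?_)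
open import Data.Fin.Subset using (Subset; Side; inside; outside; ∣_∣)
open import Data.Vec using (lookup)
open import Data.List using (List; []; _∷_; foldr; length; allFin)
open import Data.Product using (_×_; Σ; _,_)
open import Relation.Binary.PropositionalEquality using (_≡_)
open import Relation.Nullary.Decidable using (⌊_⌋)

record Graph (n : ℕ) : Set where
  field
    adj       : Fin n → Fin n → Bool
    symmetric : ∀ i j → adj i j ≡ adj j i
    irreflex  : ∀ i → adj i i ≡ false
open Graph public

-- A digraph on Fin n as a Boolean arc relation: arc i j = true means i → j.
Arcs : ℕ → Set
Arcs n = Fin n → Fin n → Bool

record IsOrientation {n : ℕ} (G : Graph n) (D : Arcs n) : Set where
  field
    arc⇒edge : ∀ i j → D i j ≡ true → adj G i j ≡ true
    edge⇒one : ∀ i j → adj G i j ≡ true → D i j ≡ not (D j i)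

countList : {A : Set} → (A → Bool) → List A → ℕ
countList P [] = 0
countList P (x ∷ xs) = (if P x then 1 else 0) + countList P xs

edgeCount : {n : ℕ} → Graph n → ℕ
edgeCount {n} G =
  foldr (λ i acc → countList (λ j → ⌊ i <? j ⌋ ∧ adj G i j) (allFin n) + acc) 0 (allFin n)

inB : {n : ℕ} → Subset n → Fin n → Bool
inB X i with lookup X i
... | inside  = true
... | outside = false

invert : {n : ℕ} → Subset n → Arcs n → Arcs n
invert X D i j = if inB X i ∧ inB X j then D j i else D i j

invertAll : {n : ℕ} → List (Subset n) → Arcs n → Arcs n
invertAll [] D = D
invertAll (X ∷ Xs) D = invertAll Xs (invert X D)

AllAtMost : {n : ℕ} → ℕ → List (Subset n) → Set
AllAtMost p [] = Data.Unit.⊤ where import Data.Unit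
AllAtMost p (X ∷ Xs) = (∣ X ∣ ≤ p) × AllAtMost p Xs

SameArcs : {n : ℕ} → Arcs n → Arcs n → Set
SameArcs D₁ D₂ = ∀ i j → D₁ i j ≡ D₂ i j

-- id^{≤p}(G) ≤ k  : any orientation can be transformed into any other
-- by at most k (≤p)-inversions.
idLeq : {n : ℕ} → ℕ → Graph n → ℕ → Set
idLeq {n} p G k =
  ∀ (D₁ D₂ : Arcs n) → IsOrientation G D₁ → IsOrientation G D₂ →
  Σ (List (Subset n)) λ Xs →
    AllAtMost p Xs × length Xs ≤ k × SameArcs (invertAll Xs D₁) D₂

{-# OPTIONS --safe #-}
module Submission where

-- Order the vertices 0, …, n and fix the target orientation one row at a time.  When
-- vertex v is treated, every edge whose lower end precedes v already agrees with the
-- target, and the forward edges vb (v < b) that still disagree are split into chunks of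
-- at most p - 1 vertices.  Inverting v together with a chunk reverses exactly the arcs
-- from v to the chunk among the edges at v, and it touches no edge whose lower end
-- precedes v (the edges inside the chunk belong to later rows).  So row v costs at most
-- ⌈d⁺(v)/(p-1)⌉ ≤ (d⁺(v) + p - 2)/(p-1) inversions, the last vertex costs nothing, and
-- summing over the rows gives (|E| + (p-2)(|V|-1))/(p-1).

open import Defs
open import Data.Nat using (ℕ; zero; suc; _+_; _*_; _∸_; _≤_; _<_; z≤n; s≤s; s≤s⁻¹; NonZero)
import Data.Nat as ℕ
open import Data.Nat.Properties hiding (_<?_)
open import Data.Nat.DivMod using (_/_; _%_; m%n<n; m≡m%n+[m/n]*n; m/n*n≤m; m*n/n≡m; /-monoˡ-≤)
open import Data.Nat.Tactic.RingSolver using (solve-∀)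
open import Data.Bool using (Bool; true; false; not; _∧_)
import Data.Bool as Bool
open import Data.Bool.Properties using (not-involutive; not-¬; ¬-not; ∧-zeroʳ)
open import Data.Fin using (Fin; toℕ; _<?_) renaming (zero to fzero; suc to fsuc)
import Data.Fin.Properties as Fin
open import Data.Fin.Subset using (Subset; inside; outside; ∣_∣; ⁅_⁆; _∪_; ⋃)
  renaming (_∈_ to _∈ₛ_; _∉_ to _∉ₛ_)
open import Data.Fin.Subset.Properties using (x∈⁅x⁆; x∈⁅y⁆⇒x≡y; ∉⊥; x∈p∪q⁺; x∈p∪q⁻; ∣⁅x⁆∣≡1; ∣⊥∣≡0)
open import Data.Vec as Vec using (lookup)
open import Data.Vec.Properties using ([]=⇒lookup; lookup⇒[]=)
open import Data.List using (List; []; _∷_; _++_; length; foldr; map; filter; take; drop; tabulate; allFin)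
open import Data.List.Properties using (length-++; length-take; length-drop; take++drop≡id)
open import Data.List.Membership.Propositional using (_∈_; _∉_)
open import Data.List.Membership.Propositional.Properties
  using (∈-++⁺ˡ; ∈-++⁺ʳ; ∈-++⁻; ∈-filter⁺; ∈-filter⁻; ∈-allFin)
open import Data.List.Relation.Unary.Any using (here; there)
open import Data.List.Relation.Unary.Any.Properties using (¬Any[])
import Data.List.Relation.Unary.All as All
open import Data.List.Relation.Unary.AllPairs using (_∷_)
open import Data.List.Relation.Unary.Unique.Propositional using (Unique)
open import Data.List.Relation.Unary.Unique.Propositional.Properties using (drop⁺; filter⁺; allFin⁺)
open import Data.Product using (Σ; _×_; _,_; proj₁; proj₂)
open import Data.Sum using (inj₁; inj₂)
open import Data.Unit using (tt)
open import Function using (id; _∘_)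
open import Relation.Binary using (tri<; tri≈; tri>)
open import Relation.Binary.PropositionalEquality
open import Relation.Nullary using (yes; no; contradiction)
open import Relation.Nullary.Decidable using (⌊_⌋; _×-dec_; dec-true; isYes≗does)
open import Relation.Unary using (Pred; Decidable)

module _ {A : Set} where

  Unique-++⇒disjoint : ∀ {xs ys : List A} {x} → Unique (xs ++ ys) → x ∈ xs → x ∉ ys
  Unique-++⇒disjoint {xs = _ ∷ xs} (x≢ ∷ _) (here refl) x∈ys = All.lookup x≢ (∈-++⁺ʳ xs x∈ys) refl
  Unique-++⇒disjoint (_ ∷ xs!) (there x∈xs) = Unique-++⇒disjoint xs! x∈xs

  length-filter≤countList : ∀ {ℓ} {P : Pred A ℓ} (P? : Decidable P) (Q : A → Bool) →
    (∀ {x} → P x → Q x ≡ true) → ∀ xs → length (filter P? xs) ≤ countList Q xs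
  length-filter≤countList P? Q P⇒Q [] = z≤n
  length-filter≤countList P? Q P⇒Q (x ∷ xs) with P? x
  ... | yes px rewrite P⇒Q px = s≤s (length-filter≤countList P? Q P⇒Q xs)
  ... | no _ = ≤-trans (length-filter≤countList P? Q P⇒Q xs) (m≤n+m _ _)

∣p∪q∣≤∣p∣+∣q∣ : ∀ {n} (p q : Subset n) → ∣ p ∪ q ∣ ≤ ∣ p ∣ + ∣ q ∣
∣p∪q∣≤∣p∣+∣q∣ Vec.[]            Vec.[]            = z≤n
∣p∪q∣≤∣p∣+∣q∣ (inside  Vec.∷ p) (inside  Vec.∷ q) = s≤s (≤-trans (∣p∪q∣≤∣p∣+∣q∣ p q) (+-monoʳ-≤ ∣ p ∣ (n≤1+n _)))
∣p∪q∣≤∣p∣+∣q∣ (inside  Vec.∷ p) (outside Vec.∷ q) = s≤s (∣p∪q∣≤∣p∣+∣q∣ p q)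
∣p∪q∣≤∣p∣+∣q∣ (outside Vec.∷ p) (inside  Vec.∷ q) = ≤-trans (s≤s (∣p∪q∣≤∣p∣+∣q∣ p q)) (≤-reflexive (sym (+-suc ∣ p ∣ ∣ q ∣)))
∣p∪q∣≤∣p∣+∣q∣ (outside Vec.∷ p) (outside Vec.∷ q) = ∣p∪q∣≤∣p∣+∣q∣ p q

fromList : ∀ {n} → List (Fin n) → Subset n
fromList xs = ⋃ (map ⁅_⁆ xs)

∣fromList∣≤length : ∀ {n} (xs : List (Fin n)) → ∣ fromList xs ∣ ≤ length xs
∣fromList∣≤length {n} []       = ≤-reflexive (∣⊥∣≡0 n)
∣fromList∣≤length      (x ∷ xs) =
  ≤-trans (∣p∪q∣≤∣p∣+∣q∣ ⁅ x ⁆ (fromList xs))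
          (+-mono-≤ (≤-reflexive (∣⁅x⁆∣≡1 x)) (∣fromList∣≤length xs))

∈⇒∈fromList : ∀ {n} {x : Fin n} {xs} → x ∈ xs → x ∈ₛ fromList xs
∈⇒∈fromList (here refl) = x∈p∪q⁺ (inj₁ (x∈⁅x⁆ _))
∈⇒∈fromList (there x∈xs) = x∈p∪q⁺ (inj₂ (∈⇒∈fromList x∈xs))

∈fromList⇒∈ : ∀ {n} {x : Fin n} xs → x ∈ₛ fromList xs → x ∈ xs
∈fromList⇒∈ []       x∈⊥ = contradiction x∈⊥ ∉⊥
∈fromList⇒∈ (y ∷ ys) x∈ with x∈p∪q⁻ ⁅ y ⁆ (fromList ys) x∈
... | inj₁ x∈⁅y⁆ = here (x∈⁅y⁆⇒x≡y y x∈⁅y⁆)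
... | inj₂ x∈ys  = there (∈fromList⇒∈ ys x∈ys)

inB≡lookup : ∀ {n} (X : Subset n) i → inB X i ≡ lookup X i
inB≡lookup X i with lookup X i
... | inside  = refl
... | outside = refl

inB-fromList-∈ : ∀ {n} {x : Fin n} xs → x ∈ xs → inB (fromList xs) x ≡ true
inB-fromList-∈ {x = x} xs x∈xs = trans (inB≡lookup (fromList xs) x) ([]=⇒lookup (∈⇒∈fromList x∈xs))

∉⇒lookup≡outside : ∀ {n} {X : Subset n} {x} → x ∉ₛ X → lookup X x ≡ outside
∉⇒lookup≡outside {X = X} {x} x∉X with lookup X x in eq
... | inside  = contradiction (lookup⇒[]= x X eq) x∉X
... | outside = refl

inB-fromList-∉ : ∀ {n} {x : Fin n} xs → x ∉ xs → inB (fromList xs) x ≡ false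
inB-fromList-∉ {x = x} xs x∉xs =
  trans (inB≡lookup (fromList xs) x) (∉⇒lookup≡outside (x∉xs ∘ ∈fromList⇒∈ xs))

m≤[m+n]/[1+n]*[1+n] : ∀ m n → m ≤ (m + n) / suc n * suc n
m≤[m+n]/[1+n]*[1+n] m n = +-cancelˡ-≤ n m _ (begin
  n + m                                        ≡⟨ +-comm n m ⟩
  m + n                                        ≡⟨ m≡m%n+[m/n]*n (m + n) (suc n) ⟩
  (m + n) % suc n + (m + n) / suc n * suc n    ≤⟨ +-monoˡ-≤ _ (s≤s⁻¹ (m%n<n (m + n) (suc n))) ⟩
  n + (m + n) / suc n * suc n                  ∎)
  where open ≤-Reasoning

m*n≤o⇒m≤o/n : ∀ m n o .{{_ : NonZero n}} → m * n ≤ o → m ≤ o / n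
m*n≤o⇒m≤o/n m n o m*n≤o = ≤-trans (≤-reflexive (sym (m*n/n≡m m n))) (/-monoˡ-≤ n m*n≤o)

module _ {N : ℕ} (X : Subset N) (D : Arcs N) {a b : Fin N} where

  invert-outˡ : inB X a ≡ false → invert X D a b ≡ D a b
  invert-outˡ a∉X rewrite a∉X = refl

  invert-outʳ : inB X b ≡ false → invert X D a b ≡ D a b
  invert-outʳ b∉X rewrite b∉X | ∧-zeroʳ (inB X a) = refl

  invert-in : inB X a ≡ true → inB X b ≡ true → invert X D a b ≡ D b a
  invert-in a∈X b∈X rewrite a∈X | b∈X = refl

invertAll-++ : ∀ {N} (Xs Ys : List (Subset N)) D → invertAll (Xs ++ Ys) D ≡ invertAll Ys (invertAll Xs D)
invertAll-++ []       Ys D = refl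
invertAll-++ (X ∷ Xs) Ys D = invertAll-++ Xs Ys (invert X D)

AllAtMost-++ : ∀ {N} p (Xs Ys : List (Subset N)) → AllAtMost p Xs → AllAtMost p Ys → AllAtMost p (Xs ++ Ys)
AllAtMost-++ p []       Ys _              Ys≤p = Ys≤p
AllAtMost-++ p (X ∷ Xs) Ys (X≤p , Xs≤p) Ys≤p = X≤p , AllAtMost-++ p Xs Ys Xs≤p Ys≤p

module _ {N : ℕ} {G : Graph N} {D : Arcs N} (D-orient : IsOrientation G D) where
  open IsOrientation D-orient

  reverse-arc : ∀ {a b} → adj G a b ≡ true → D b a ≡ not (D a b)
  reverse-arc {a} {b} ab = edge⇒one b a (trans (symmetric G b a) ab)

  no-arc : ∀ {a b} → adj G a b ≡ false → D a b ≡ false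
  no-arc {a} {b} ab with D a b in arc
  ... | false = refl
  ... | true  = contradiction (trans (sym (arc⇒edge a b arc)) ab) λ ()

  invert-isOrientation : ∀ X → IsOrientation G (invert X D)
  IsOrientation.arc⇒edge (invert-isOrientation X) i j arc with inB X i | inB X j
  ... | true  | true  = trans (symmetric G i j) (arc⇒edge j i arc)
  ... | true  | false = arc⇒edge i j arc
  ... | false | _     = arc⇒edge i j arc
  IsOrientation.edge⇒one (invert-isOrientation X) i j ij with inB X i | inB X j
  ... | true  | true  = edge⇒one j i (trans (symmetric G j i) ij)
  ... | true  | false = edge⇒one i j ij
  ... | false | true  = edge⇒one i j ij
  ... | false | false = edge⇒one i j ij

-- Each inversion costs `cost` units of the budget; with cost = p - 1 this lets
-- the bound (p-1)k ≤ |E| + (p-2)(|V|-1) be accumulated without division.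
module Reachability (p cost : ℕ) {N : ℕ} where

  record Reach (budget : ℕ) (D : Arcs N) (Goal : Arcs N → Set) : Set where
    constructor reach
    field
      steps   : List (Subset N)
      small   : AllAtMost p steps
      cheap   : length steps * cost ≤ budget
      reached : Goal (invertAll steps D)

  reach-here : ∀ {budget D Goal} → Goal D → Reach budget D Goal
  reach-here goal = reach [] tt z≤n goal

  reach-invert : ∀ {D Goal} X → ∣ X ∣ ≤ p → Goal (invert X D) → Reach cost D Goal
  reach-invert X X≤p goal = reach (X ∷ []) (X≤p , tt) (≤-reflexive (+-identityʳ cost)) goal

  reach-weaken : ∀ {b b′ D Goal} → b ≤ b′ → Reach b D Goal → Reach b′ D Goal
  reach-weaken b≤b′ (reach Xs Xs≤p spent goal) = reach Xs Xs≤p (≤-trans spent b≤b′) goal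

  reach-then : ∀ {b c D P Q} → Reach b D P → (∀ {D′} → P D′ → Reach c D′ Q) → Reach (b + c) D Q
  reach-then {b} {c} {D} {Q = Q} (reach Xs Xs≤p spent mid) continue with continue mid
  ... | reach Ys Ys≤p spent′ goal =
    reach (Xs ++ Ys)
      (AllAtMost-++ p Xs Ys Xs≤p Ys≤p)
      (begin
        length (Xs ++ Ys) * cost            ≡⟨ cong (_* cost) (length-++ Xs) ⟩
        (length Xs + length Ys) * cost      ≡⟨ *-distribʳ-+ cost (length Xs) (length Ys) ⟩
        length Xs * cost + length Ys * cost ≤⟨ +-mono-≤ spent spent′ ⟩
        b + c                               ∎)
      (subst Q (sym (invertAll-++ Xs Ys D)) goal)
    where open ≤-Reasoning

module RowByRow {N : ℕ} (G : Graph N) {D₂ : Arcs N} (D₂-orient : IsOrientation G D₂) (q′ : ℕ) where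

  open import Data.List.Membership.DecPropositional (Fin._≟_ {N}) using (_∈?_)

  q : ℕ
  q = suc q′

  open Reachability (suc q) q

  outdeg : Fin N → ℕ
  outdeg v = countList (λ b → ⌊ v <? b ⌋ ∧ adj G v b) (allFin N)

  record RowsFixed (i : ℕ) (D : Arcs N) : Set where
    field
      orientation : IsOrientation G D
      agrees      : ∀ a b → toℕ a < i → toℕ a < toℕ b → adj G a b ≡ true → D a b ≡ D₂ a b

  invert-RowsFixed : ∀ {i D} X → (∀ a → toℕ a < i → inB X a ≡ false) →
    RowsFixed i D → RowsFixed i (invert X D)
  invert-RowsFixed {D = D} X avoids fixed = record
    { orientation = invert-isOrientation orientation X
    ; agrees      = λ a b a<i a<b ab → trans (invert-outˡ X D (avoids a a<i)) (agrees a b a<i a<b ab)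
    }
    where open RowsFixed fixed

  below-last : ∀ {i} → suc i ≡ N → ∀ {a b : Fin N} → toℕ a < toℕ b → toℕ a < i
  below-last 1+i≡N {b = b} a<b = <-≤-trans a<b (s≤s⁻¹ (subst (toℕ b <_) (sym 1+i≡N) (Fin.toℕ<n b)))

  -- The last vertex has no forward edges, so its row never needs fixing.
  RowsFixed⇒SameArcs : ∀ {i D} → RowsFixed i D → suc i ≡ N → SameArcs D D₂
  RowsFixed⇒SameArcs {i} {D} fixed 1+i≡N a b with adj G a b in ab | Fin.<-cmp a b
  ... | false | _             = trans (no-arc orientation ab) (sym (no-arc D₂-orient ab))
    where open RowsFixed fixed
  ... | true  | tri< a<b _ _  = agrees a b (below-last 1+i≡N a<b) a<b ab
    where open RowsFixed fixed
  ... | true  | tri≈ _ refl _ = contradiction (trans (sym ab) (irreflex G a)) λ ()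
  ... | true  | tri> _ _ b<a  = begin
    D a b         ≡⟨ reverse-arc orientation ba ⟩
    not (D b a)   ≡⟨ cong not (agrees b a (below-last 1+i≡N b<a) b<a ba) ⟩
    not (D₂ b a)  ≡⟨ sym (reverse-arc D₂-orient ba) ⟩
    D₂ a b        ∎
    where
      open RowsFixed fixed
      open ≡-Reasoning
      ba : adj G b a ≡ true
      ba = trans (symmetric G b a) ab

  Misoriented : Arcs N → Fin N → Fin N → Set
  Misoriented D v b = toℕ v < toℕ b × adj G v b ≡ true × D v b ≡ not (D₂ v b)

  misoriented? : ∀ D v → Decidable (Misoriented D v)
  misoriented? D v b = toℕ v ℕ.<? toℕ b ×-dec adj G v b Bool.≟ true ×-dec D v b Bool.≟ not (D₂ v b)

  record RowPending (v : Fin N) (ws : List (Fin N)) (D : Arcs N) : Set where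
    field
      unique      : Unique ws
      misoriented : ∀ {b} → b ∈ ws → Misoriented D v b
      complete    : ∀ {b} → Misoriented D v b → b ∈ ws

  misorientedList : Arcs N → Fin N → List (Fin N)
  misorientedList D v = filter (misoriented? D v) (allFin N)

  misorientedList-pending : ∀ D v → RowPending v (misorientedList D v) D
  misorientedList-pending D v = record
    { unique      = filter⁺ (misoriented? D v) (allFin⁺ N)
    ; misoriented = proj₂ ∘ ∈-filter⁻ (misoriented? D v) {xs = allFin N}
    ; complete    = ∈-filter⁺ (misoriented? D v) (∈-allFin _)
    }

  length-misorientedList≤outdeg : ∀ D v → length (misorientedList D v) ≤ outdeg v
  length-misorientedList≤outdeg D v =
    length-filter≤countList (misoriented? D v) (λ b → ⌊ v <? b ⌋ ∧ adj G v b)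
      (λ { {b} (v<b , vb , _) → cong₂ _∧_ (trans (isYes≗does (v <? b)) (dec-true (v <? b) v<b)) vb }) (allFin N)

  RowPending[]⇒RowsFixed : ∀ {v D} → RowsFixed (toℕ v) D → RowPending v [] D → RowsFixed (suc (toℕ v)) D
  RowPending[]⇒RowsFixed {v} {D} fixed pending = record { orientation = orientation ; agrees = agrees′ }
    where
      open RowsFixed fixed
      open RowPending pending
      agrees′ : ∀ a b → toℕ a < suc (toℕ v) → toℕ a < toℕ b → adj G a b ≡ true → D a b ≡ D₂ a b
      agrees′ a b a≤v a<b ab with m<1+n⇒m<n∨m≡n a≤v
      ... | inj₁ a<v = agrees a b a<v a<b ab
      ... | inj₂ a≡v with Fin.toℕ-injective a≡v
      ...   | refl = trans (¬-not λ wrong → ¬Any[] (complete (a<b , ab , wrong))) (not-involutive _)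

  module RowStep {v ws D} (fixed : RowsFixed (toℕ v) D) (pending : RowPending v ws D) where
    open RowsFixed fixed
    open RowPending pending

    chunk : List (Fin N)
    chunk = take q ws

    X : Subset N
    X = fromList (v ∷ chunk)

    D′ : Arcs N
    D′ = invert X D

    ∣X∣≤1+q : ∣ X ∣ ≤ suc q
    ∣X∣≤1+q = ≤-trans (∣fromList∣≤length (v ∷ chunk))
                      (s≤s (≤-trans (≤-reflexive (length-take q ws)) (m⊓n≤m q (length ws))))

    chunk++rest : chunk ++ drop q ws ≡ ws
    chunk++rest = take++drop≡id q ws

    chunk⊆ws : ∀ {b} → b ∈ chunk → b ∈ ws
    chunk⊆ws b∈chunk = subst (_ ∈_) chunk++rest (∈-++⁺ˡ b∈chunk)

    rest⊆ws : ∀ {b} → b ∈ drop q ws → b ∈ ws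
    rest⊆ws b∈rest = subst (_ ∈_) chunk++rest (∈-++⁺ʳ chunk b∈rest)

    chunk∩rest : ∀ {b} → b ∈ chunk → b ∉ drop q ws
    chunk∩rest = Unique-++⇒disjoint (subst Unique (sym chunk++rest) unique)

    outside-X : ∀ {b} → toℕ v < toℕ b → b ∉ chunk → inB X b ≡ false
    outside-X v<b b∉chunk = inB-fromList-∉ (v ∷ chunk) λ
      { (here refl)     → <-irrefl refl v<b
      ; (there b∈chunk) → b∉chunk b∈chunk
      }

    X-avoids-earlier : ∀ a → toℕ a < toℕ v → inB X a ≡ false
    X-avoids-earlier a a<v = inB-fromList-∉ (v ∷ chunk) λ
      { (here refl)     → <-irrefl refl a<v
      ; (there a∈chunk) → <-asym a<v (proj₁ (misoriented (chunk⊆ws a∈chunk)))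
      }

    unchanged : ∀ {b} → toℕ v < toℕ b → b ∉ chunk → D′ v b ≡ D v b
    unchanged v<b b∉chunk = invert-outʳ X D (outside-X v<b b∉chunk)

    corrected : ∀ {b} → b ∈ chunk → D′ v b ≡ D₂ v b
    corrected {b} b∈chunk with misoriented (chunk⊆ws b∈chunk)
    ... | _ , vb , wrong = begin
      D′ v b              ≡⟨ invert-in X D (inB-fromList-∈ (v ∷ chunk) (here refl))
                                           (inB-fromList-∈ (v ∷ chunk) (there b∈chunk)) ⟩
      D b v               ≡⟨ reverse-arc orientation vb ⟩
      not (D v b)         ≡⟨ cong not wrong ⟩
      not (not (D₂ v b))  ≡⟨ not-involutive _ ⟩
      D₂ v b              ∎
      where open ≡-Reasoning

    rest-misoriented : ∀ {b} → b ∈ drop q ws → Misoriented D′ v b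
    rest-misoriented b∈rest with misoriented (rest⊆ws b∈rest)
    ... | v<b , vb , wrong = v<b , vb , trans (unchanged v<b (λ b∈chunk → chunk∩rest b∈chunk b∈rest)) wrong

    rest-complete : ∀ {b} → Misoriented D′ v b → b ∈ drop q ws
    rest-complete {b} (v<b , vb , wrong′) with b ∈? chunk
    ... | yes b∈chunk = contradiction wrong′ (not-¬ (corrected b∈chunk))
    ... | no  b∉chunk with ∈-++⁻ chunk (subst (b ∈_) (sym chunk++rest)
                             (complete (v<b , vb , trans (sym (unchanged v<b b∉chunk)) wrong′)))
    ...   | inj₁ b∈chunk = contradiction b∈chunk b∉chunk
    ...   | inj₂ b∈rest  = b∈rest

    fixed′ : RowsFixed (toℕ v) D′
    fixed′ = invert-RowsFixed X X-avoids-earlier fixed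

    pending′ : RowPending v (drop q ws) D′
    pending′ = record
      { unique      = drop⁺ q unique
      ; misoriented = rest-misoriented
      ; complete    = rest-complete
      }

  rowStep : ∀ {v ws D} → RowsFixed (toℕ v) D → RowPending v ws D →
    Reach q D (λ D′ → RowsFixed (toℕ v) D′ × RowPending v (drop q ws) D′)
  rowStep fixed pending = reach-invert X ∣X∣≤1+q (fixed′ , pending′)
    where open RowStep fixed pending

  -- Once ws is exhausted the remaining rounds invert {v} alone, which changes nothing.
  fixRow : ∀ k {v ws D} → length ws ≤ k * q → RowsFixed (toℕ v) D → RowPending v ws D →
    Reach (k * q) D (RowsFixed (suc (toℕ v)))
  fixRow zero    {ws = []}    _   fixed pending = reach-here (RowPending[]⇒RowsFixed fixed pending)
  fixRow (suc k) {ws = ws} len fixed pending =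
    reach-then (rowStep fixed pending) λ (fixed′ , pending′) → fixRow k len′ fixed′ pending′
    where
      len′ : length (drop q ws) ≤ k * q
      len′ = ≤-trans (≤-reflexive (length-drop q ws)) (m≤n+o⇒m∸n≤o (length ws) q len)

  fixVertex : ∀ v {i D} → toℕ v ≡ i → RowsFixed i D → Reach (outdeg v + q′) D (RowsFixed (suc i))
  fixVertex v {D = D} refl fixed =
    reach-weaken (m/n*n≤m (outdeg v + q′) q)
      (fixRow ((outdeg v + q′) / q)
        (≤-trans (length-misorientedList≤outdeg D v) (m≤[m+n]/[1+n]*[1+n] (outdeg v) q′))
        fixed (misorientedList-pending D v))

  -- sumOutdeg (allFin N) is edgeCount G by definition.
  sumOutdeg : List (Fin N) → ℕ
  sumOutdeg = foldr (λ v total → outdeg v + total) 0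

  sweep : ∀ m {i} (f : Fin (suc m) → Fin N) → (∀ k → toℕ (f k) ≡ i + toℕ k) → i + suc m ≡ N →
    ∀ {D} → RowsFixed i D → Reach (sumOutdeg (tabulate f) + q′ * m) D (λ D′ → SameArcs D′ D₂)
  sweep zero    {i} f _ i+1≡N fixed = reach-here (RowsFixed⇒SameArcs fixed (trans (+-comm 1 i) i+1≡N))
  sweep (suc m) {i} f f-index i+m≡N fixed =
    reach-weaken (≤-reflexive (shuffle (outdeg (f fzero)) (sumOutdeg (tabulate (f ∘ fsuc))) q′ m))
      (reach-then (fixVertex (f fzero) (trans (f-index fzero) (+-identityʳ i)) fixed)
        (sweep m (f ∘ fsuc) (λ k → trans (f-index (fsuc k)) (+-suc i (toℕ k)))
                           (trans (sym (+-suc i (suc m))) i+m≡N)))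
    where
      shuffle : ∀ a b c m → (a + c) + (b + c * m) ≡ (a + b) + c * suc m
      shuffle = solve-∀

idLeq-bound : ∀ q′ n (G : Graph (suc n)) → idLeq (2 + q′) G ((edgeCount G + q′ * n) / suc q′)
idLeq-bound q′ n G D₁ D₂ D₁-orient D₂-orient =
  steps , small , m*n≤o⇒m≤o/n (length steps) (suc q′) _ cheap , reached
  where
    open RowByRow G D₂-orient q′
    start : RowsFixed 0 D₁
    start = record { orientation = D₁-orient ; agrees = λ _ _ () }
    open Reachability.Reach (sweep n id (λ _ → refl) refl start)

theorem13 : (p : ℕ) → 2 < p → (n : ℕ) → (G : Graph (suc n)) →
    Σ ℕ λ k → ((p ∸ 1) * k ≤ edgeCount G + (p ∸ 2) * n) × idLeq p G k
theorem13 (suc (suc q′)) _ n G =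
  budget / suc q′ ,
  ≤-trans (≤-reflexive (*-comm (suc q′) (budget / suc q′))) (m/n*n≤m budget (suc q′)) ,
  idLeq-bound q′ n G
  where
    budget : ℕ
    budget = edgeCount G + q′ * n
theorem13 (suc zero) (s≤s ()) _ _
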